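{- Let $n\geq 1$ and let $P_n$ be the directed path on $n$ vertices. Then $\gamma^+_{maj}(P_n)=0$ if $n$ is even and $\gamma^+_{maj}(P_n)=1$ if $n$ is odd.
   Context: Digraphs are finite, without loops or multiple arcs (pairs of opposite arcs allowed). For a digraph $D=(V,A)$ and $u\in V$, $N^+[u]=\{u\}\cup\{v: uv\in A\}$. For $f:V\to\{ -1,1\}$ and $X\subseteq V$, $f(X)=\sum_{v\in X}f(v)$. A majority out-dominating function (MODF) of $D$ is a function $f:V\to\{ -1,1\}$ with $|\{v\in V: f(N^+[v])\geq1\}|\geq |V|/2$; its weight is $w(f)=f(V)$. $\gamma^+_{maj}(D)$ is the minimum weight of a MODF of $D$. -}

module Defs where

open import Data.Nat as ℕ using (ℕ; zero; suc)
open import Data.Fin using (Fin; toℕ)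
import Data.Fin as Fin
open import Data.Integer as ℤ using (ℤ)
open import Data.Bool using (Bool; true; false; if_then_else_; _∨_)
open import Data.Sign using (Sign)
open import Data.Product using (Σ; _×_)
open import Relation.Nullary.Decidable using (⌊_⌋; does)
open import Relation.Binary.PropositionalEquality using (_≡_)

record Digraph (n : ℕ) : Set where
  field
    arc    : Fin n → Fin n → Bool
    noLoop : ∀ u → arc u u ≡ false
open Digraph public

sumFin : ∀ {n} → (Fin n → ℤ) → ℤ
sumFin {zero}  g = ℤ.0ℤ
sumFin {suc n} g = g Fin.zero ℤ.+ sumFin (λ i → g (Fin.suc i))

countFin : ∀ {n} → (Fin n → Bool) → ℕ
countFin {zero}  p = 0
countFin {suc n} p = (if p Fin.zero then 1 else 0) ℕ.+ countFin (λ i → p (Fin.suc i))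

-- A function f : V → {-1,1}; Sign.+ means 1, Sign.- means -1.
SignFun : ℕ → Set
SignFun n = Fin n → Sign

val : Sign → ℤ
val Sign.+ = ℤ.1ℤ
val Sign.- = ℤ.-1ℤ

inClosedOut : ∀ {n} → Digraph n → Fin n → Fin n → Bool
inClosedOut D u v = ⌊ v Fin.≟ u ⌋ ∨ arc D u v

fClosedOut : ∀ {n} → Digraph n → SignFun n → Fin n → ℤ
fClosedOut D f u = sumFin (λ v → if inClosedOut D u v then val (f v) else ℤ.0ℤ)

weight : ∀ {n} → SignFun n → ℤ
weight f = sumFin (λ v → val (f v))

good : ∀ {n} → Digraph n → SignFun n → Fin n → Bool
good D f v = ⌊ ℤ.1ℤ ℤ.≤? fClosedOut D f v ⌋

-- f is a MODF:  |{v : f(N⁺[v]) ≥ 1}| ≥ |V|/2, i.e. 2·|…| ≥ n.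
IsMODF : ∀ {n} → Digraph n → SignFun n → Set
IsMODF {n} D f = n ℕ.≤ 2 ℕ.* countFin (good D f)

IsMajOutDomNumber : ∀ {n} → Digraph n → ℤ → Set
IsMajOutDomNumber D k =
  Σ (SignFun _) (λ f → IsMODF D f × weight f ≡ k)
  × (∀ f → IsMODF D f → k ℤ.≤ weight f)

pathArc : ∀ {n} → Fin n → Fin n → Bool
pathArc i j = does (toℕ j ℕ.≟ suc (toℕ i))

open import Data.Nat.Properties using (<⇒≢; n<1+n)
open import Relation.Nullary.Decidable using (dec-false)

pathNoLoop : ∀ {n} (u : Fin n) → pathArc u u ≡ false
pathNoLoop u = dec-false (toℕ u ℕ.≟ suc (toℕ u)) (<⇒≢ (n<1+n (toℕ u)))

directedPath : (n : ℕ) → Digraph n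
directedPath n = record { arc = pathArc ; noLoop = pathNoLoop }

module Submission where

-- Write #⁺f for the number of vertices with f(v) = 1, so that w(f) = 2·#⁺f - n.
-- Lower bound: in P_n the closed out-neighbourhood of u is {u} together with
-- at most one successor, so f(N⁺[u]) = f(u) + (0 or ±1).  Hence a vertex with
-- f(u) = -1 is never good, #good ≤ #⁺f, and for a MODF n ≤ 2·#good ≤ 2·#⁺f.
-- Thus w(f) = 2·#⁺f - n is a natural number congruent to n modulo 2, so it is
-- at least n mod 2.
-- Upper bound: the threshold function that is -1 on the first ⌊n/2⌋ vertices
-- and +1 afterwards makes every +1 vertex good (its successor is +1 as well),
-- so it is a MODF with ⌈n/2⌉ positive vertices, i.e. of weight n mod 2.

open import Defs
open import Data.Nat using (ℕ; _≥_)
open import Data.Nat.Divisibility using (_∣_)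
open import Data.Integer using (0ℤ; 1ℤ)
open import Data.Product using (_×_)
open import Relation.Nullary using (¬_)

open import Function using (_∘_)
open import Data.Nat as ℕ using (zero; suc; _≤_; _∸_; _/_; _%_; z≤n; s≤s)
import Data.Nat.Properties as ℕP
open import Data.Nat.Solver using (module +-*-Solver)
open import Data.Nat.DivMod using (m≡m%n+[m/n]*n; m*n%n≡0; m%n<n)
open import Data.Nat.Divisibility using (n∣m⇒m%n≡0; m%n≡0⇒n∣m)
open import Data.Integer as ℤ using (ℤ; +_; _⊖_; -1ℤ)
import Data.Integer.Properties as ℤP
open import Algebra.Properties.CommutativeSemigroup ℤP.+-commutativeSemigroup
  using (interchange)
open import Data.Fin as Fin using (Fin; toℕ)
open import Data.Sign using (Sign)
open import Data.Bool using (Bool; true; false; if_then_else_)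
open import Data.Product using (Σ; _,_)
open import Data.Sum using (_⊎_; inj₁; inj₂)
open import Relation.Nullary using (yes; no; contradiction)
open import Relation.Nullary.Decidable using (does; ⌊_⌋; dec-true; dec-false)
open import Relation.Binary.PropositionalEquality
open ≡-Reasoning

sumFin-cong : ∀ {n} {g h : Fin n → ℤ} → (∀ i → g i ≡ h i) → sumFin g ≡ sumFin h
sumFin-cong {zero}  eq = refl
sumFin-cong {suc n} eq = cong₂ ℤ._+_ (eq Fin.zero) (sumFin-cong (eq ∘ Fin.suc))

sumFin-+ : ∀ {n} (g h : Fin n → ℤ) → sumFin (λ i → g i ℤ.+ h i) ≡ sumFin g ℤ.+ sumFin h
sumFin-+ {zero}  g h = refl
sumFin-+ {suc n} g h = begin
  (g₀ ℤ.+ h₀) ℤ.+ sumFin (λ i → g (Fin.suc i) ℤ.+ h (Fin.suc i))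
    ≡⟨ cong (λ s → (g₀ ℤ.+ h₀) ℤ.+ s) (sumFin-+ (g ∘ Fin.suc) (h ∘ Fin.suc)) ⟩
  (g₀ ℤ.+ h₀) ℤ.+ (sumFin (g ∘ Fin.suc) ℤ.+ sumFin (h ∘ Fin.suc))
    ≡⟨ interchange g₀ h₀ _ _ ⟩
  (g₀ ℤ.+ sumFin (g ∘ Fin.suc)) ℤ.+ (h₀ ℤ.+ sumFin (h ∘ Fin.suc)) ∎
  where
  g₀ = g Fin.zero
  h₀ = h Fin.zero

sumFin-zero : ∀ {n} → sumFin {n} (λ _ → 0ℤ) ≡ 0ℤ
sumFin-zero {zero}  = refl
sumFin-zero {suc n} = trans (ℤP.+-identityˡ _) (sumFin-zero {n})

sumFin-at : ∀ {n} (u : Fin n) (h : Fin n → ℤ) →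
  sumFin (λ v → if does (v Fin.≟ u) then h v else 0ℤ) ≡ h u
sumFin-at {suc n} Fin.zero    h = trans (cong (λ s → h Fin.zero ℤ.+ s) (sumFin-zero {n})) (ℤP.+-identityʳ _)
sumFin-at {suc n} (Fin.suc u) h = trans (ℤP.+-identityˡ _) (sumFin-at u (h ∘ Fin.suc))

sumFin-at-index : ∀ {n} (m : ℕ) (h : Fin n → ℤ) →
  let S = sumFin (λ v → if does (toℕ v ℕ.≟ m) then h v else 0ℤ) in
  (Σ (Fin n) λ w → toℕ w ≡ m × S ≡ h w) ⊎ S ≡ 0ℤ
sumFin-at-index {zero}  m       h = inj₂ refl
sumFin-at-index {suc n} zero    h =
  inj₁ (Fin.zero , refl , trans (cong (λ s → h Fin.zero ℤ.+ s) (sumFin-zero {n})) (ℤP.+-identityʳ _))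
sumFin-at-index {suc n} (suc m) h with sumFin-at-index m (h ∘ Fin.suc)
... | inj₁ (w , w≡m , S≡) = inj₁ (Fin.suc w , cong suc w≡m , trans (ℤP.+-identityˡ _) S≡)
... | inj₂ S≡0           = inj₂ (trans (ℤP.+-identityˡ _) S≡0)

countFin-mono : ∀ {n} {p q : Fin n → Bool} →
  (∀ v → p v ≡ true → q v ≡ true) → countFin p ≤ countFin q
countFin-mono {zero}          p⇒q = z≤n
countFin-mono {suc n} {p} {q} p⇒q with p Fin.zero in p₀ | q Fin.zero in q₀
... | true  | true  = s≤s (countFin-mono (p⇒q ∘ Fin.suc))
... | true  | false = contradiction (trans (sym (p⇒q Fin.zero p₀)) q₀) λ ()
... | false | true  = ℕP.m≤n⇒m≤1+n (countFin-mono (p⇒q ∘ Fin.suc))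
... | false | false = countFin-mono (p⇒q ∘ Fin.suc)

positive : Sign → Bool
positive Sign.+ = true
positive Sign.- = false

#positive : ∀ {n} → SignFun n → ℕ
#positive f = countFin (positive ∘ f)

weight-positive : ∀ {n} (f : SignFun n) → weight f ≡ (2 ℕ.* #positive f) ⊖ n
weight-positive {zero}  f = refl
weight-positive {suc n} f with f Fin.zero | weight-positive (f ∘ Fin.suc)
... | Sign.+ | ih = begin
  1ℤ ℤ.+ weight (f ∘ Fin.suc)  ≡⟨ cong (λ s → 1ℤ ℤ.+ s) ih ⟩
  1ℤ ℤ.+ (2c ⊖ n)              ≡⟨ ℤP.distribʳ-⊖-+-pos 1 2c n ⟩
  suc 2c ⊖ n                   ≡⟨ ℤP.[1+m]⊖[1+n]≡m⊖n (suc 2c) n ⟨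
  suc (suc 2c) ⊖ suc n         ≡⟨ cong (_⊖ suc n) (ℕP.*-suc 2 c) ⟨
  (2 ℕ.* suc c) ⊖ suc n        ∎
  where
  c  = #positive (f ∘ Fin.suc)
  2c = 2 ℕ.* c
... | Sign.- | ih = trans (cong (λ s → -1ℤ ℤ.+ s) ih) (ℤP.distribʳ-⊖-+-neg 0 _ n)

fOut : ∀ {n} → Digraph n → SignFun n → Fin n → ℤ
fOut D f u = sumFin (λ v → if arc D u v then val (f v) else 0ℤ)

-- As D has no loops, N⁺[u] is the disjoint union of {u} and N⁺(u).
fClosedOut-split : ∀ {n} (D : Digraph n) (f : SignFun n) (u : Fin n) →
  fClosedOut D f u ≡ val (f u) ℤ.+ fOut D f u
fClosedOut-split D f u = begin
  fClosedOut D f u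
    ≡⟨ sumFin-cong split ⟩
  sumFin (λ v → self v ℤ.+ out v)
    ≡⟨ sumFin-+ self out ⟩
  sumFin self ℤ.+ fOut D f u
    ≡⟨ cong (ℤ._+ fOut D f u) (sumFin-at u (val ∘ f)) ⟩
  val (f u) ℤ.+ fOut D f u ∎
  where
  self out : Fin _ → ℤ
  self v = if does (v Fin.≟ u) then val (f v) else 0ℤ
  out  v = if arc D u v then val (f v) else 0ℤ
  split : ∀ v → (if inClosedOut D u v then val (f v) else 0ℤ) ≡
                (if does (v Fin.≟ u) then val (f v) else 0ℤ) ℤ.+
                (if arc D u v then val (f v) else 0ℤ)
  split v with v Fin.≟ u
  ... | yes refl rewrite noLoop D u = sym (ℤP.+-identityʳ _)
  ... | no _                        = sym (ℤP.+-identityˡ _)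

path-fOut : ∀ {n} (f : SignFun n) (u : Fin n) →
  (Σ (Fin n) λ w → toℕ w ≡ suc (toℕ u) × fOut (directedPath n) f u ≡ val (f w))
  ⊎ fOut (directedPath n) f u ≡ 0ℤ
path-fOut f u = sumFin-at-index (suc (toℕ u)) (val ∘ f)

negative-plus-not-good : ∀ s → ⌊ 1ℤ ℤ.≤? -1ℤ ℤ.+ val s ⌋ ≡ false
negative-plus-not-good Sign.+ = refl
negative-plus-not-good Sign.- = refl

-- In P_n a vertex u with f(u) = -1 has f(N⁺[u]) = -1 + (0 or ±1) < 1.
negative-not-good : ∀ {n} (f : SignFun n) (u : Fin n) →
  f u ≡ Sign.- → good (directedPath n) f u ≡ false
negative-not-good f u fu rewrite fClosedOut-split (directedPath _) f u | fu
  with path-fOut f u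
... | inj₁ (w , _ , out≡) rewrite out≡ = negative-plus-not-good (f w)
... | inj₂ out≡0          rewrite out≡0 = refl

good⇒positive : ∀ {n} (f : SignFun n) (v : Fin n) →
  good (directedPath n) f v ≡ true → positive (f v) ≡ true
good⇒positive f v isGood with f v in fv
... | Sign.+ = refl
... | Sign.- = contradiction (trans (sym isGood) (negative-not-good f v fv)) λ ()

-- If n ≤ 2m then 2m - n ≥ n mod 2, because 2m - n ≡ n (mod 2).
parity-gap : ∀ n m → n ≤ 2 ℕ.* m → n % 2 ≤ 2 ℕ.* m ∸ n
parity-gap n m n≤2m with 2 ℕ.* m ∸ n in gap
... | suc _ = ℕP.≤-trans (ℕP.≤-pred (m%n<n n 2)) (s≤s z≤n)
... | zero  = ℕP.≤-reflexive n%2≡0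
  where
  n≡2m : n ≡ 2 ℕ.* m
  n≡2m = ℕP.≤-antisym n≤2m (ℕP.m∸n≡0⇒m≤n gap)
  n%2≡0 : n % 2 ≡ 0
  n%2≡0 = begin
    n % 2          ≡⟨ cong (_% 2) (trans n≡2m (ℕP.*-comm 2 m)) ⟩
    (m ℕ.* 2) % 2  ≡⟨ m*n%n≡0 m 2 ⟩
    0              ∎

-- Every MODF f of P_n satisfies n ≤ 2·#good ≤ 2·#⁺f, so w(f) = 2·#⁺f - n ≥ n mod 2.
modf-weight-bound : ∀ {n} (f : SignFun n) →
  IsMODF (directedPath n) f → + (n % 2) ℤ.≤ weight f
modf-weight-bound {n} f modf =
  subst (+ (n % 2) ℤ.≤_) (sym weight≡) (ℤ.+≤+ (parity-gap n (#positive f) n≤2c))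
  where
  n≤2c : n ≤ 2 ℕ.* #positive f
  n≤2c = ℕP.≤-trans modf (ℕP.*-monoʳ-≤ 2 (countFin-mono (good⇒positive f)))
  weight≡ : weight f ≡ + (2 ℕ.* #positive f ∸ n)
  weight≡ = trans (weight-positive f) (ℤP.⊖-≥ n≤2c)

threshold : ∀ {n} → ℕ → SignFun n
threshold k v = if does (toℕ v ℕP.<? k) then Sign.- else Sign.+

threshold-positive : ∀ {n} k (v : Fin n) → k ≤ toℕ v → threshold k v ≡ Sign.+
threshold-positive k v k≤v =
  cong (λ b → if b then Sign.- else Sign.+) (dec-false (toℕ v ℕP.<? k) (ℕP.≤⇒≯ k≤v))

threshold-negative : ∀ {n} k (v : Fin n) → toℕ v ℕ.< k → threshold k v ≡ Sign.-
threshold-negative k v v<k =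
  cong (λ b → if b then Sign.- else Sign.+) (dec-true (toℕ v ℕP.<? k) v<k)

positive-threshold⇒≤ : ∀ {n} k (v : Fin n) → positive (threshold k v) ≡ true → k ≤ toℕ v
positive-threshold⇒≤ k v isPositive with k ℕP.≤? toℕ v
... | yes k≤v = k≤v
... | no  k≰v =
  contradiction (trans (sym isPositive) (cong positive (threshold-negative k v (ℕP.≰⇒> k≰v)))) λ ()

#positive-threshold : ∀ n k → #positive (threshold {n} k) ≡ n ∸ k
#positive-threshold zero    zero    = refl
#positive-threshold zero    (suc k) = refl
#positive-threshold (suc n) zero    = cong suc (#positive-threshold n zero)
#positive-threshold (suc n) (suc k) = #positive-threshold n k

-- Under a threshold every positive vertex u of P_n is good: its successor,
-- if any, is positive too, so f(N⁺[u]) ∈ {1, 2}.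
threshold-good : ∀ {n} k (u : Fin n) → k ≤ toℕ u → good (directedPath n) (threshold k) u ≡ true
threshold-good k u k≤u
  rewrite fClosedOut-split (directedPath _) (threshold k) u | threshold-positive k u k≤u
  with path-fOut (threshold k) u
... | inj₂ out≡0 rewrite out≡0 = refl
... | inj₁ (w , w≡u+1 , out≡)
  rewrite out≡
        | threshold-positive k w (ℕP.≤-trans k≤u (subst (toℕ u ≤_) (sym w≡u+1) (ℕP.n≤1+n _)))
  = refl

threshold-#good : ∀ n k → n ∸ k ≤ countFin (good (directedPath n) (threshold k))
threshold-#good n k = subst (_≤ countFin (good (directedPath n) (threshold k))) (#positive-threshold n k)
  (countFin-mono {n} λ v isPositive → threshold-good k v (positive-threshold⇒≤ k v isPositive))

twice-ceil-half : ∀ n → 2 ℕ.* (n ∸ n / 2) ≡ n % 2 ℕ.+ n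
twice-ceil-half n = begin
  2 ℕ.* (n ∸ h)                  ≡⟨ cong (λ m → 2 ℕ.* (m ∸ h)) n≡ ⟩
  2 ℕ.* (r ℕ.+ h ℕ.* 2 ∸ h)      ≡⟨ cong (λ m → 2 ℕ.* (m ∸ h)) (split-twice r h) ⟩
  2 ℕ.* (r ℕ.+ h ℕ.+ h ∸ h)      ≡⟨ cong (2 ℕ.*_) (ℕP.m+n∸n≡m (r ℕ.+ h) h) ⟩
  2 ℕ.* (r ℕ.+ h)                ≡⟨ double-sum r h ⟩
  r ℕ.+ (r ℕ.+ h ℕ.* 2)          ≡⟨ cong (r ℕ.+_) n≡ ⟨
  r ℕ.+ n                        ∎
  where
  h = n / 2
  r = n % 2
  n≡ : n ≡ r ℕ.+ h ℕ.* 2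
  n≡ = m≡m%n+[m/n]*n n 2
  open +-*-Solver
  split-twice : ∀ r h → r ℕ.+ h ℕ.* 2 ≡ r ℕ.+ h ℕ.+ h
  split-twice = solve 2 (λ r h → r :+ h :* con 2 := r :+ h :+ h) refl
  double-sum : ∀ r h → 2 ℕ.* (r ℕ.+ h) ≡ r ℕ.+ (r ℕ.+ h ℕ.* 2)
  double-sum = solve 2 (λ r h → con 2 :* (r :+ h) := r :+ (r :+ h :* con 2)) refl

half-threshold : ∀ n →
  IsMODF (directedPath n) (threshold (n / 2)) × weight (threshold {n} (n / 2)) ≡ + (n % 2)
half-threshold n = isMODF , weight≡
  where
  isMODF : n ≤ 2 ℕ.* countFin (good (directedPath n) (threshold (n / 2)))
  isMODF = ℕP.≤-trans (ℕP.m≤n+m n (n % 2))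
    (subst (_≤ 2 ℕ.* countFin (good (directedPath n) (threshold (n / 2)))) (twice-ceil-half n) (ℕP.*-monoʳ-≤ 2 (threshold-#good n (n / 2))))
  weight≡ : weight (threshold {n} (n / 2)) ≡ + (n % 2)
  weight≡ = begin
    weight (threshold {n} (n / 2))                ≡⟨ weight-positive (threshold {n} (n / 2)) ⟩
    (2 ℕ.* #positive (threshold {n} (n / 2))) ⊖ n ≡⟨ cong (λ c → (2 ℕ.* c) ⊖ n) (#positive-threshold n (n / 2)) ⟩
    (2 ℕ.* (n ∸ n / 2)) ⊖ n                       ≡⟨ cong (_⊖ n) (twice-ceil-half n) ⟩
    (n % 2 ℕ.+ n) ⊖ n                             ≡⟨ ℤP.⊖-≥ (ℕP.m≤n+m n (n % 2)) ⟩
    + (n % 2 ℕ.+ n ∸ n)                           ≡⟨ cong +_ (ℕP.m+n∸n≡m (n % 2) n) ⟩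
    + (n % 2)                                     ∎

path-majOutDomNumber : ∀ n → IsMajOutDomNumber (directedPath n) (+ (n % 2))
path-majOutDomNumber n = (threshold (n / 2) , half-threshold n) , modf-weight-bound

odd⇒%2≡1 : ∀ n → ¬ (2 ∣ n) → n % 2 ≡ 1
odd⇒%2≡1 n 2∤n with n % 2 in n%2 | m%n<n n 2
... | zero        | _ = contradiction (m%n≡0⇒n∣m n 2 n%2) 2∤n
... | suc zero    | _ = refl
... | suc (suc _) | s≤s (s≤s ())

proposition3p2 : (n : ℕ) → n ≥ 1 →
    (2 ∣ n → IsMajOutDomNumber (directedPath n) 0ℤ)
    × (¬ (2 ∣ n) → IsMajOutDomNumber (directedPath n) 1ℤ)
proposition3p2 n _ = even , odd
  where
  γ≡ : ∀ {r} → n % 2 ≡ r → IsMajOutDomNumber (directedPath n) (+ r)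
  γ≡ n%2≡r = subst (IsMajOutDomNumber (directedPath n) ∘ +_) n%2≡r (path-majOutDomNumber n)
  even : 2 ∣ n → IsMajOutDomNumber (directedPath n) 0ℤ
  even 2∣n = γ≡ (n∣m⇒m%n≡0 n 2 2∣n)
  odd : ¬ (2 ∣ n) → IsMajOutDomNumber (directedPath n) 1ℤ
  odd 2∤n = γ≡ (odd⇒%2≡1 n 2∤n)
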